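{- Let $n\in\mathbb N$, let $p\ge n$ be a prime, and let $h\colon[n]\to\mathbb Z_p$, $h(x)=ax+b \bmod p$ with $a\in\mathbb Z_p\setminus\{0\}$, $b\in\mathbb Z_p$, be a linear congruential map. Let $\pi\colon[n]\to\operatorname{im}(h)$ be its sorted rank-map. If $y\in\operatorname{im}(h)$ and $x,x'\in[n]$ satisfy $\pi(x)\le y\le\pi(x')$, then $$y-(\pi(x')-x')\ \le\ \pi^{ -1}(y)\ \le\ y-(\pi(x)-x).$$
   Context: $[n]=\{1,\dots,n\}$ and $\mathbb Z_p=\{0,1,\dots,p-1\}$, viewed as integers. For an injective map $h\colon[n]\to\mathbb N$, let $\pi_h$ be the permutation of $[n]$ that sorts $(h(i))_{i=1}^n$ ascendingly; the sorted rank-map is $\pi=h\circ\pi_h\colon[n]\to\operatorname{im}(h)$, i.e. the strictly increasing bijection from $[n]$ onto $\operatorname{im}(h)$ ($\pi(x)$ is the $x$-th smallest element of $\operatorname{im}(h)$), and $\pi^{ -1}(y)$ is the rank of $y$ in $\operatorname{im}(h)$. -}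

module Defs where

open import Data.Nat using (ℕ; _+_; _*_; _≤_; _<_; NonZero)
open import Data.Nat.DivMod using (_%_)
open import Data.Product using (_×_; Σ; ∃; _,_)
open import Relation.Binary.PropositionalEquality using (_≡_)

InN : ℕ → ℕ → Set
InN n x = 1 ≤ x × x ≤ n

lcg : (p a b : ℕ) → .{{NonZero p}} → ℕ → ℕ
lcg p a b x = (a * x + b) % p

InImage : ℕ → (ℕ → ℕ) → ℕ → Set
InImage n h y = Σ ℕ λ z → InN n z × h z ≡ y

-- π is the sorted rank-map of h on [n]: the strictly increasing
-- bijection from [n] onto im(h|[n]) (only its values on [n] matter).
IsSortedRankMap : ℕ → (ℕ → ℕ) → (ℕ → ℕ) → Set
IsSortedRankMap n h π =
    (∀ x x' → InN n x → InN n x' → x < x' → π x < π x')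
  × (∀ x → InN n x → InImage n h (π x))
  × (∀ y → InImage n h y → Σ ℕ λ x → InN n x × π x ≡ y)

module Submission where

open import Defs
open import Data.Nat using (ℕ; _≤_; _<_; NonZero; zero; suc; _+_; _∸_; s≤s; z≤n)
open import Data.Nat.Properties
open import Data.Nat.Primality using (Prime)
open import Data.Integer using (+_; -_; _-_; +≤+) renaming (_≤_ to _≤ℤ_; _+_ to _+ℤ_)
import Data.Integer.Properties as ℤ
open import Data.Integer.Tactic.RingSolver using (solve-∀)
open import Data.Product using (_×_; _,_)
open import Relation.Binary.PropositionalEquality

-- The argument only uses that π is strictly increasing on [n]: consecutive values of π
-- differ by at least one, so π x − x is nondecreasing on [n].  Comparing π r − r with
-- π x − x and π x' − x' gives the two bounds.

StrictlyIncreasingOn : ℕ → (ℕ → ℕ) → Set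
StrictlyIncreasingOn n π = ∀ x x' → InN n x → InN n x' → x < x' → π x < π x'

module _ {n : ℕ} {π : ℕ → ℕ} (π-mono : StrictlyIncreasingOn n π) where

  π[u]+k≤π[u+k] : ∀ {u} k → InN n u → u + k ≤ n → π u + k ≤ π (u + k)
  π[u]+k≤π[u+k] {u} zero _ _ rewrite +-identityʳ u | +-identityʳ (π u) = ≤-refl
  π[u]+k≤π[u+k] {u} (suc k) u∈@(1≤u , _) u+1+k≤n = begin
    π u + suc k        ≡⟨ +-suc (π u) k ⟩
    suc (π u + k)      ≤⟨ s≤s (π[u]+k≤π[u+k] k u∈ (<⇒≤ u+k<n)) ⟩
    suc (π (u + k))    ≤⟨ π-mono (u + k) (suc (u + k)) u+k∈ u+1+k∈ ≤-refl ⟩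
    π (suc (u + k))    ≡⟨ cong π (+-suc u k) ⟨
    π (u + suc k)      ∎
    where
    open ≤-Reasoning
    u+k<n : u + k < n
    u+k<n = subst (_≤ n) (+-suc u k) u+1+k≤n
    u+k∈ : InN n (u + k)
    u+k∈ = ≤-trans 1≤u (m≤m+n u k) , <⇒≤ u+k<n
    u+1+k∈ : InN n (suc (u + k))
    u+1+k∈ = s≤s z≤n , u+k<n

  π-reflects-≤ : ∀ {u v} → InN n u → InN n v → π u ≤ π v → u ≤ v
  π-reflects-≤ u∈ v∈ πu≤πv = ≮⇒≥ (λ v<u → <⇒≱ (π-mono _ _ v∈ u∈ v<u) πu≤πv)

  π[u]+v≤π[v]+u : ∀ {u v} → InN n u → InN n v → π u ≤ π v → π u + v ≤ π v + u
  π[u]+v≤π[v]+u {u} {v} u∈ v∈@(_ , v≤n) πu≤πv = begin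
    π u + v              ≡⟨ cong (_+_ (π u)) (trans (sym u+d≡v) (+-comm u d)) ⟩
    π u + (d + u)        ≡⟨ +-assoc (π u) d u ⟨
    π u + d + u          ≤⟨ +-monoˡ-≤ u (subst (λ w → π u + d ≤ π w) u+d≡v
                              (π[u]+k≤π[u+k] d u∈ (subst (_≤ n) (sym u+d≡v) v≤n))) ⟩
    π v + u              ∎
    where
    open ≤-Reasoning
    d : ℕ
    d = v ∸ u
    u+d≡v : u + d ≡ v
    u+d≡v = m+[n∸m]≡n (π-reflects-≤ u∈ v∈ πu≤πv)

ℤ-+-cancelʳ-≤ : ∀ k {i j} → i +ℤ k ≤ℤ j +ℤ k → i ≤ℤ j
ℤ-+-cancelʳ-≤ k {i} {j} i+k≤j+k =
  subst₂ _≤ℤ_ (i+k-k≡i i k) (i+k-k≡i j k) (ℤ.+-monoˡ-≤ (- k) i+k≤j+k)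
  where
  i+k-k≡i : ∀ i k → i +ℤ k - k ≡ i
  i+k-k≡i = solve-∀

[i-[k-l]]+k≡i+l : ∀ i k l → (i - (k - l)) +ℤ k ≡ i +ℤ l
[i-[k-l]]+k≡i+l = solve-∀

module _ (y c d r : ℕ) where

  +[y+d]≡y-[c-d]+c : + (y + d) ≡ (+ y - (+ c - + d)) +ℤ + c
  +[y+d]≡y-[c-d]+c = trans (ℤ.pos-+ y d) (sym ([i-[k-l]]+k≡i+l (+ y) (+ c) (+ d)))

  +[c+r]≡r+c : + (c + r) ≡ + r +ℤ + c
  +[c+r]≡r+c = trans (ℤ.pos-+ c r) (ℤ.+-comm (+ c) (+ r))

  y+d≤c+r⇒y-[c-d]≤r : y + d ≤ c + r → + y - (+ c - + d) ≤ℤ + r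
  y+d≤c+r⇒y-[c-d]≤r y+d≤c+r =
    ℤ-+-cancelʳ-≤ (+ c) (subst₂ _≤ℤ_ +[y+d]≡y-[c-d]+c +[c+r]≡r+c (+≤+ y+d≤c+r))

  c+r≤y+d⇒r≤y-[c-d] : c + r ≤ y + d → + r ≤ℤ + y - (+ c - + d)
  c+r≤y+d⇒r≤y-[c-d] c+r≤y+d =
    ℤ-+-cancelʳ-≤ (+ c) (subst₂ _≤ℤ_ +[c+r]≡r+c +[y+d]≡y-[c-d]+c (+≤+ c+r≤y+d))

proposition2 : (n p a b : ℕ) .{{_ : NonZero p}} → Prime p → n ≤ p
    → 1 ≤ a → a < p → b < p
    → (π : ℕ → ℕ) → IsSortedRankMap n (lcg p a b) π
    → (y x x' : ℕ) → InImage n (lcg p a b) y → InN n x → InN n x'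
    → π x ≤ y → y ≤ π x'
    → (r : ℕ) → InN n r → π r ≡ y
    → ((+ y) - ((+ π x') - (+ x')) ≤ℤ (+ r)) × ((+ r) ≤ℤ (+ y) - ((+ π x) - (+ x)))
proposition2 n p a b _ _ _ _ _ π (π-mono , _) y x x' _ x∈ x'∈ πx≤y y≤πx' r r∈ refl =
    y+d≤c+r⇒y-[c-d]≤r (π r) (π x') x' r (π[u]+v≤π[v]+u π-mono r∈ x'∈ y≤πx')
  , c+r≤y+d⇒r≤y-[c-d] (π r) (π x) x r (π[u]+v≤π[v]+u π-mono x∈ r∈ πx≤y)
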